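{- Let $Q=2^m$, let $\epsilon\in\{1,-1\}$, $\ell\in\mathcal L_\epsilon$ and $a\in\mathbb F_Q$. Let $v_a(\epsilon)$ be the number of non-tangent lines $n\ne\ell$ with $\hat\rho(\ell,n)=a$. Then $$v_a(\epsilon)=\begin{cases}2(Q-1)\delta_{\epsilon,1},&\text{if }a=0,\\ Q-\epsilon,&\text{if }a\in\mathbb F_Q^*.\end{cases}$$
   Context: Let $Q=2^m$ and work in $\mathrm{PG}(2,Q)$. Conic and lines. - Points are nonzero vectors up to scalars, and $(a,b,c)^\perp$ denotes the line $aX+bY+cZ=0$. - The conic is $\mathcal O=\{(\xi,\xi^2,1)^\top:\xi\in\mathbb F_Q\}\cup\{(0,1,0)^\top\}$. - The non-tangent lines (meeting $\mathcal O$ in $0$ or $2$ points) are exactly the lines $(1,x,y)^\perp$, $x,y\in\mathbb F_Q$. - Such a line lies in $\mathcal L_1$ (secant) if $\mathrm{Tr}(xy)=0$ and in $\mathcal L_{ -1}$ (exterior) if $\mathrm{Tr}(xy)=1$, where $\mathrm{Tr}$ is the absolute trace $\mathbb F_Q\to\mathbb F_2$. Modified cross-ratio. - For $\ell=(1,x,y)^\perp$ and $n=(1,z,u)^\perp$: $\hat\rho(\ell,n)=x^2u^2+y^2z^2+(x+z)(y+u)$. $\delta$ is the Kronecker delta. -}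

module Defs where

open import Level using (0ℓ)
open import Data.Nat using (ℕ; zero; suc; _∸_) renaming (_+_ to _+ℕ_; _*_ to _*ℕ_; _^_ to _^ℕ_)
open import Data.Product using (_×_; _,_; ∃)
open import Data.List using (List; length; filter; cartesianProduct)
open import Data.List.Membership.Propositional using (_∈_)
open import Data.List.Relation.Unary.Unique.Propositional using (Unique)
open import Relation.Binary.PropositionalEquality using (_≡_)
open import Relation.Binary.Definitions using (DecidableEquality)
open import Relation.Nullary using (¬_; Dec; yes; no)
open import Relation.Nullary.Decidable using (_×-dec_; ¬?)
open import Data.Product.Properties using (≡-dec)
open import Algebra.Structures using (IsCommutativeRing)

record FiniteField2 (m : ℕ) : Set₁ where
  infixl 6 _+_
  infixl 7 _*_
  field
    Carrier : Set
    _+_ _*_ : Carrier → Carrier → Carrier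
    -_      : Carrier → Carrier
    0# 1#   : Carrier
    isCommutativeRing : IsCommutativeRing _≡_ _+_ _*_ -_ 0# 1#
    0≢1     : ¬ (0# ≡ 1#)
    inverse : ∀ x → ¬ (x ≡ 0#) → ∃ λ y → x * y ≡ 1#
    _≟_     : DecidableEquality Carrier
    elements : List Carrier
    complete : ∀ x → x ∈ elements
    unique   : Unique elements
    card     : length elements ≡ 2 ^ℕ m

  _^_ : Carrier → ℕ → Carrier
  x ^ zero  = 1#
  x ^ suc n = x * (x ^ n)

  traceSum : ℕ → Carrier → Carrier
  traceSum zero    x = 0#
  traceSum (suc i) x = x ^ (2 ^ℕ i) + traceSum i x

  Tr : Carrier → Carrier
  Tr x = traceSum m x

  -- modified cross-ratio of (1,x,y)^⊥ and (1,z,u)^⊥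
  ρ̂ : Carrier × Carrier → Carrier × Carrier → Carrier
  ρ̂ (x , y) (z , u) = (x * x) * (u * u) + (y * y) * (z * z) + (x + z) * (y + u)

  -- all non-tangent lines (1,x,y)^⊥, indexed by (x,y) ∈ F_Q × F_Q
  nonTangentLines : List (Carrier × Carrier)
  nonTangentLines = cartesianProduct elements elements

  _≟²_ : DecidableEquality (Carrier × Carrier)
  _≟²_ = ≡-dec _≟_ _≟_

data Sign : Set where
  plus minus : Sign

module _ {m : ℕ} (K : FiniteField2 m) where
  open FiniteField2 K

  -- Tr value characterising L_ε : L_1 ⇔ Tr(xy)=0, L_{-1} ⇔ Tr(xy)=1
  trOf : Sign → Carrier
  trOf plus  = 0#
  trOf minus = 1#

  v : Carrier × Carrier → Carrier → ℕ
  v ℓ a = length (filter (λ n → ¬? (n ≟² ℓ) ×-dec (ρ̂ ℓ n ≟ a)) nonTangentLines)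

vZero : ℕ → Sign → ℕ
vZero m plus  = 2 *ℕ (2 ^ℕ m ∸ 1)
vZero m minus = 0

vNonzero : ℕ → Sign → ℕ
vNonzero m plus  = 2 ^ℕ m ∸ 1
vNonzero m minus = 2 ^ℕ m +ℕ 1

-- Translating by ℓ = (x, y) turns n ↦ ρ̂(ℓ, n) into the binary quadratic form
-- q(s, t) = x²t² + y²s² + st, so v_a counts the points p ≠ 0 of 𝔽_Q² with q(p) = a.
-- Every a ≠ 0 is a square l², and p ↦ l p carries the level set q = 1 onto q = a, so all
-- nonzero levels have the same size N₁; as the Q² − 1 points p ≠ 0 are spread over the
-- Q levels, N₀ + (Q − 1) N₁ = Q² − 1.  If Tr(xy) = 1 the form is anisotropic, since a zero
-- (s, t) with s ≠ 0 would give (xy)² = ℘(x²t/s) with ℘ w = w² + w, whence Tr(xy) = 0;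
-- so N₀ = 0.  If Tr(xy) = 0, the additive Hilbert 90 yields γ with q(1, γ) = 0, and two
-- shears turn q into st, whose zeros p ≠ 0 are the 2(Q − 1) points on the axes.
--
-- The finite-field facts come from the record alone: x^Q = x by comparing the products of
-- all z and all x z (with 0 counted as 1), characteristic 2 from (−1)^Q = 1, Tr ≠ 0 since
-- the trace polynomial has degree Q/2 < Q, and ℘ w = c for Tr c = 0 via the explicit
-- solution w = Σ_{k<m} (Σ_{i<k} c^(2^i)) δ^(2^k), where Tr δ = 1.

module Submission where

open import Algebra.Bundles using (CommutativeMonoid; CommutativeRing; RawRing)
open import Algebra.Core using (Op₂)
open import Algebra.Solver.Ring.AlmostCommutativeRing using (fromCommutativeRing; _-Raw-AlmostCommutative⟶_)
open import Algebra.Structures using (IsCommutativeMonoid)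
open import Data.Bool using (Bool; true; false; _xor_)
import Data.Bool.Properties as Bool
open import Data.List using (List; []; _∷_; _++_; map; foldr; filter; length; cartesianProduct)
open import Data.List.Membership.Propositional using (_∈_; lose)
open import Data.List.Membership.Propositional.Properties using (∈-map⁺; ∈-cartesianProduct⁺)
open import Data.List.Membership.Propositional.Properties.WithK using (unique∧set⇒bag)
open import Data.List.Properties using (map-∘; length-++; length-map)
open import Data.List.Relation.Binary.BagAndSetEquality using (∼bag⇒↭)
open import Data.List.Relation.Binary.Permutation.Propositional using (_↭_; ↭⇒↭ₛ)
import Data.List.Relation.Binary.Permutation.Propositional.Properties as ↭
import Data.List.Relation.Unary.All as All
open import Data.List.Relation.Unary.Any using (here; there; any?; satisfied)
open import Data.List.Relation.Unary.Unique.Propositional using (Unique; _∷_)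
import Data.List.Relation.Unary.Unique.Propositional.Properties as Unique
open import Data.Maybe using (Maybe)
import Data.Maybe as Maybe
open import Data.Nat using (ℕ; zero; suc; _∸_; _<_; _≤_; z≤n; s≤s; s<s; NonZero; >-nonZero) renaming (_+_ to _+ℕ_; _*_ to _*ℕ_; _^_ to _^ℕ_)
import Data.Nat.Properties as ℕ
open import Data.Product using (_×_; _,_; proj₁; proj₂; Σ)
open import Data.Product.Function.NonDependent.Propositional using (_×-⇔_; _×-↔_)
open import Data.Sum using (_⊎_; inj₁; inj₂; [_,_]′)
open import Function using (_∘_; id; _⇔_; _↔_; Equivalence; Inverse; Injection; mk⇔; mk↔ₛ′)
open import Function.Construct.Composition using (_↔-∘_)
open import Function.Properties.Inverse using (↔⇒↣)
open import Function.Related.TypeIsomorphisms using (¬-cong-⇔)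
open import Level using (0ℓ)
open import Relation.Binary.Consequences using (dec⇒weaklyDec)
open import Relation.Binary.Definitions using (DecidableEquality)
open import Relation.Binary.PropositionalEquality
open import Relation.Nullary using (¬_; Dec; yes; no; ¬?; _×-dec_; contradiction)
open import Relation.Nullary.Decidable using (decidable-stable)
open import Relation.Unary using (Pred; Decidable)

open import Defs

to-≡-⇔ : {A B : Set} (σ : A ↔ B) {a : A} {b : B} → Inverse.to σ a ≡ b →
         ∀ p → Inverse.to σ p ≡ b ⇔ p ≡ a
to-≡-⇔ σ σa≡b p = mk⇔ (λ σp≡b → Injection.injective (↔⇒↣ σ) (trans σp≡b (sym σa≡b)))
                      (λ p≡a → trans (cong (Inverse.to σ) p≡a) σa≡b)

map-↔-↭ : {B : Set} {E : List B} → Unique E → (∀ b → b ∈ E) →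
          (σ : B ↔ B) → map (Inverse.to σ) E ↭ E
map-↔-↭ {E = E} unique complete σ =
  ∼bag⇒↭ (unique∧set⇒bag (Unique.map⁺ (Injection.injective (↔⇒↣ σ)) unique) unique
    λ {b} → mk⇔ (λ _ → complete b) (λ _ → subst (_∈ map to E) (strictlyInverseˡ b) (∈-map⁺ to (complete (from b)))))
  where open Inverse σ

length-cartesianProduct : {B C : Set} (xs : List B) (ys : List C) →
                          length (cartesianProduct xs ys) ≡ length xs *ℕ length ys
length-cartesianProduct []       ys = refl
length-cartesianProduct (x ∷ xs) ys = begin
  length (map (x ,_) ys ++ cartesianProduct xs ys)           ≡⟨ length-++ (map (x ,_) ys) ⟩
  length (map (x ,_) ys) +ℕ length (cartesianProduct xs ys)  ≡⟨ cong₂ _+ℕ_ (length-map (x ,_) ys)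
                                                                           (length-cartesianProduct xs ys) ⟩
  length ys +ℕ length xs *ℕ length ys                        ∎
  where open ≡-Reasoning

length≡1⇒≡ : {B : Set} {xs : List B} {x y : B} → length xs ≡ 1 → x ∈ xs → y ∈ xs → x ≡ y
length≡1⇒≡ {xs = _ ∷ []} refl (here refl) (here refl) = refl

module BigOperator {A : Set} {_∙_ : Op₂ A} {ε : A}
                   (isCommutativeMonoid : IsCommutativeMonoid _≡_ _∙_ ε) where

  private
    commutativeMonoid : CommutativeMonoid 0ℓ 0ℓ
    commutativeMonoid = record { isCommutativeMonoid = isCommutativeMonoid }

  open CommutativeMonoid commutativeMonoid using (assoc; identityˡ; rawMonoid; commutativeSemigroup)
  open import Algebra.Definitions.RawMonoid rawMonoid public using () renaming (_×_ to _·_)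
  open import Algebra.Properties.CommutativeSemigroup commutativeSemigroup using (interchange; x∙yz≈y∙xz; xy∙z≈x∙zy)
  open import Data.List.Relation.Binary.Permutation.Setoid.Properties (setoid A) using (foldr-commMonoid)
  open ≡-Reasoning

  private variable
    B C : Set
    xs ys : List B
    f g : B → A

  ∑ : List B → (B → A) → A
  ∑ xs f = foldr _∙_ ε (map f xs)

  ∑-cong∈ : ∀ (xs : List B) → (∀ {z} → z ∈ xs → f z ≡ g z) → ∑ xs f ≡ ∑ xs g
  ∑-cong∈ []       f≗g = refl
  ∑-cong∈ (x ∷ xs) f≗g = cong₂ _∙_ (f≗g (here refl)) (∑-cong∈ xs (f≗g ∘ there))

  ∑-cong : ∀ (xs : List B) → (∀ z → f z ≡ g z) → ∑ xs f ≡ ∑ xs g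
  ∑-cong xs f≗g = ∑-cong∈ xs λ {z} _ → f≗g z

  ∑-ε : ∀ (xs : List B) → ∑ xs (λ _ → ε) ≡ ε
  ∑-ε []       = refl
  ∑-ε (x ∷ xs) = trans (cong (ε ∙_) (∑-ε xs)) (identityˡ ε)

  ∑-const : ∀ (xs : List B) c → ∑ xs (λ _ → c) ≡ length xs · c
  ∑-const []       c = refl
  ∑-const (x ∷ xs) c = cong (c ∙_) (∑-const xs c)

  ∑-++ : ∀ (xs ys : List B) f → ∑ (xs ++ ys) f ≡ ∑ xs f ∙ ∑ ys f
  ∑-++ []       ys f = sym (identityˡ _)
  ∑-++ (x ∷ xs) ys f = trans (cong (f x ∙_) (∑-++ xs ys f)) (sym (assoc _ _ _))

  ∑-map : ∀ (g : B → C) xs (f : C → A) → ∑ (map g xs) f ≡ ∑ xs (f ∘ g)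
  ∑-map g xs f = cong (foldr _∙_ ε) (sym (map-∘ xs))

  ∑-distrib : ∀ (xs : List B) f g → ∑ xs (λ z → f z ∙ g z) ≡ ∑ xs f ∙ ∑ xs g
  ∑-distrib []       f g = sym (identityˡ ε)
  ∑-distrib (x ∷ xs) f g = trans (cong ((f x ∙ g x) ∙_) (∑-distrib xs f g)) (interchange _ _ _ _)

  ∑-comm : ∀ (xs : List B) (ys : List C) (h : B → C → A) →
           ∑ xs (λ s → ∑ ys (h s)) ≡ ∑ ys (λ t → ∑ xs (λ s → h s t))
  ∑-comm []       ys h = sym (∑-ε ys)
  ∑-comm (x ∷ xs) ys h = begin
    ∑ ys (h x) ∙ ∑ xs (λ s → ∑ ys (h s))          ≡⟨ cong (∑ ys (h x) ∙_) (∑-comm xs ys h) ⟩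
    ∑ ys (h x) ∙ ∑ ys (λ t → ∑ xs (λ s → h s t))  ≡⟨ ∑-distrib ys (h x) _ ⟨
    ∑ ys (λ t → h x t ∙ ∑ xs (λ s → h s t))       ∎

  ∑-cartesianProduct : ∀ (xs : List B) (ys : List C) (h : B × C → A) →
                       ∑ (cartesianProduct xs ys) h ≡ ∑ xs (λ s → ∑ ys (λ t → h (s , t)))
  ∑-cartesianProduct []       ys h = refl
  ∑-cartesianProduct (x ∷ xs) ys h = begin
    ∑ (map (x ,_) ys ++ cartesianProduct xs ys) h                 ≡⟨ ∑-++ (map (x ,_) ys) _ h ⟩
    ∑ (map (x ,_) ys) h ∙ ∑ (cartesianProduct xs ys) h            ≡⟨ cong₂ _∙_ (∑-map (x ,_) ys h)
                                                                               (∑-cartesianProduct xs ys h) ⟩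
    ∑ ys (λ t → h (x , t)) ∙ ∑ xs (λ s → ∑ ys (λ t → h (s , t)))  ∎

  ∑-↭ : xs ↭ ys → ∑ xs f ≡ ∑ ys f
  ∑-↭ {f = f} p = foldr-commMonoid isCommutativeMonoid (↭⇒↭ₛ (↭.map⁺ f p))

  ∑-update : ∀ {a : B} → Unique xs → a ∈ xs → (∀ z → ¬ z ≡ a → f z ≡ g z) →
             ∑ xs f ∙ g a ≡ f a ∙ ∑ xs g
  ∑-update {xs = a ∷ xs} {f = f} {g} (a∉xs ∷ _) (here refl) f≗g = begin
    (f a ∙ ∑ xs f) ∙ g a  ≡⟨ xy∙z≈x∙zy _ _ _ ⟩
    f a ∙ (g a ∙ ∑ xs f)  ≡⟨ cong (λ s → f a ∙ (g a ∙ s))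
                                  (∑-cong∈ xs λ z∈ → f≗g _ (All.lookup a∉xs z∈ ∘ sym)) ⟩
    f a ∙ (g a ∙ ∑ xs g)  ∎
  ∑-update {xs = x ∷ xs} {f = f} {g} {a} (x∉xs ∷ unique) (there a∈xs) f≗g = begin
    (f x ∙ ∑ xs f) ∙ g a   ≡⟨ assoc _ _ _ ⟩
    f x ∙ (∑ xs f ∙ g a)   ≡⟨ cong (f x ∙_) (∑-update unique a∈xs f≗g) ⟩
    f x ∙ (f a ∙ ∑ xs g)   ≡⟨ x∙yz≈y∙xz _ _ _ ⟩
    f a ∙ (f x ∙ ∑ xs g)   ≡⟨ cong (λ b → f a ∙ (b ∙ ∑ xs g)) (f≗g x (All.lookup x∉xs a∈xs)) ⟩
    f a ∙ (g x ∙ ∑ xs g)   ∎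

  ∑-reindex : ∀ {E : List B} → Unique E → (∀ b → b ∈ E) →
              (σ : B ↔ B) (h : B → A) → ∑ E (h ∘ Inverse.to σ) ≡ ∑ E h
  ∑-reindex {E = E} unique complete σ h =
    trans (sym (∑-map (Inverse.to σ) E h)) (∑-↭ (map-↔-↭ unique complete σ))

module Counting where

  open import Data.Nat using (_+_; _*_)

  open BigOperator ℕ.+-0-isCommutativeMonoid public

  private variable
    B : Set

  𝟙 : {P : Set} → Dec P → ℕ
  𝟙 (yes _) = 1
  𝟙 (no _)  = 0

  𝟙-cong : {P R : Set} → P ⇔ R → (P? : Dec P) (R? : Dec R) → 𝟙 P? ≡ 𝟙 R?
  𝟙-cong P⇔R (yes _) (yes _) = refl
  𝟙-cong P⇔R (yes p) (no ¬r) = contradiction (Equivalence.to P⇔R p) ¬r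
  𝟙-cong P⇔R (no ¬p) (yes r) = contradiction (Equivalence.from P⇔R r) ¬p
  𝟙-cong P⇔R (no _)  (no _)  = refl

  𝟙-yes : {P : Set} → P → (P? : Dec P) → 𝟙 P? ≡ 1
  𝟙-yes p (yes _) = refl
  𝟙-yes p (no ¬p) = contradiction p ¬p

  𝟙-no : {P : Set} → ¬ P → (P? : Dec P) → 𝟙 P? ≡ 0
  𝟙-no ¬p (yes p) = contradiction p ¬p
  𝟙-no ¬p (no _)  = refl

  ·≡* : ∀ n c → n · c ≡ n * c
  ·≡* zero    c = refl
  ·≡* (suc n) c = cong (c +_) (·≡* n c)

  count : {P : Pred B 0ℓ} → Decidable P → List B → ℕ
  count P? xs = length (filter P? xs)

  count≡∑ : {P : Pred B 0ℓ} (P? : Decidable P) (xs : List B) → count P? xs ≡ ∑ xs (𝟙 ∘ P?)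
  count≡∑ P? []       = refl
  count≡∑ P? (x ∷ xs) with P? x
  ... | yes _ = cong suc (count≡∑ P? xs)
  ... | no _  = count≡∑ P? xs

  count-cong : {P R : Pred B 0ℓ} (P? : Decidable P) (R? : Decidable R) → (∀ z → P z ⇔ R z) →
               (xs : List B) → count P? xs ≡ count R? xs
  count-cong P? R? P⇔R xs = begin
    count P? xs       ≡⟨ count≡∑ P? xs ⟩
    ∑ xs (𝟙 ∘ P?)     ≡⟨ ∑-cong xs (λ z → 𝟙-cong (P⇔R z) (P? z) (R? z)) ⟩
    ∑ xs (𝟙 ∘ R?)     ≡⟨ count≡∑ R? xs ⟨
    count R? xs       ∎
    where open ≡-Reasoning

  count-none : {P : Pred B 0ℓ} (P? : Decidable P) → (∀ z → ¬ P z) → (xs : List B) → count P? xs ≡ 0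
  count-none P? ¬P xs = trans (count≡∑ P? xs) (trans (∑-cong xs (λ z → 𝟙-no (¬P z) (P? z))) (∑-ε xs))

  count-cartesianProduct : {C : Set} {P : Pred (B × C) 0ℓ} (P? : Decidable P) (xs : List B) (ys : List C) →
                           count P? (cartesianProduct xs ys) ≡ ∑ xs (λ s → count (λ t → P? (s , t)) ys)
  count-cartesianProduct P? xs ys = begin
    count P? (cartesianProduct xs ys)                ≡⟨ count≡∑ P? (cartesianProduct xs ys) ⟩
    ∑ (cartesianProduct xs ys) (𝟙 ∘ P?)              ≡⟨ ∑-cartesianProduct xs ys (𝟙 ∘ P?) ⟩
    ∑ xs (λ s → ∑ ys (λ t → 𝟙 (P? (s , t))))         ≡⟨ ∑-cong xs (λ s → count≡∑ (λ t → P? (s , t)) ys) ⟨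
    ∑ xs (λ s → count (λ t → P? (s , t)) ys)         ∎
    where open ≡-Reasoning

  module Enumeration {E : List B} (unique : Unique E) (complete : ∀ b → b ∈ E) where

    count-reindex : {P R : Pred B 0ℓ} (σ : B ↔ B) (P? : Decidable P) (R? : Decidable R) →
                    (∀ z → P (Inverse.to σ z) ⇔ R z) → count P? E ≡ count R? E
    count-reindex σ P? R? P∘σ⇔R = begin
      count P? E                        ≡⟨ count≡∑ P? E ⟩
      ∑ E (𝟙 ∘ P?)                      ≡⟨ ∑-reindex unique complete σ (𝟙 ∘ P?) ⟨
      ∑ E (𝟙 ∘ P? ∘ Inverse.to σ)       ≡⟨ ∑-cong E (λ z → 𝟙-cong (P∘σ⇔R z) _ (R? z)) ⟩
      ∑ E (𝟙 ∘ R?)                      ≡⟨ count≡∑ R? E ⟨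
      count R? E                        ∎
      where open ≡-Reasoning

    module _ (_≟_ : DecidableEquality B) (c : B) where

      count-≡ : count (_≟ c) E ≡ 1
      count-≡ = begin
        count (_≟ c) E                    ≡⟨ count≡∑ (_≟ c) E ⟩
        ∑ E (λ z → 𝟙 (z ≟ c))             ≡⟨ ℕ.+-identityʳ _ ⟨
        ∑ E (λ z → 𝟙 (z ≟ c)) + 0         ≡⟨ ∑-update unique (complete c) (λ z z≢c → 𝟙-no z≢c (z ≟ c)) ⟩
        𝟙 (c ≟ c) + ∑ E (λ _ → 0)         ≡⟨ cong₂ _+_ (𝟙-yes refl (c ≟ c)) (∑-ε E) ⟩
        1                                 ∎
        where open ≡-Reasoning

      count-≢ : count (λ z → ¬? (z ≟ c)) E + 1 ≡ length E
      count-≢ = begin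
        count (λ z → ¬? (z ≟ c)) E + 1   ≡⟨ cong (_+ 1) (count≡∑ (λ z → ¬? (z ≟ c)) E) ⟩
        ∑ E (λ z → 𝟙 (¬? (z ≟ c))) + 1   ≡⟨ ∑-update unique (complete c) (λ z z≢c → 𝟙-yes z≢c (¬? (z ≟ c))) ⟩
        𝟙 (¬? (c ≟ c)) + ∑ E (λ _ → 1)   ≡⟨ cong₂ _+_ (𝟙-no (λ c≢c → c≢c refl) (¬? (c ≟ c))) (∑-const E 1) ⟩
        length E · 1                     ≡⟨ ·≡* (length E) 1 ⟩
        length E * 1                     ≡⟨ ℕ.*-identityʳ (length E) ⟩
        length E                         ∎
        where open ≡-Reasoning

    count-fibres : {C : Set} {P : Pred C 0ℓ} (_≟_ : DecidableEquality B) (P? : Decidable P) (f : C → B) →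
                   (xs : List C) → ∑ E (λ a → count (λ b → P? b ×-dec (f b ≟ a)) xs) ≡ count P? xs
    count-fibres _≟_ P? f xs = begin
      ∑ E (λ a → count (λ b → P? b ×-dec (f b ≟ a)) xs)       ≡⟨ ∑-cong E (λ a → count≡∑ _ xs) ⟩
      ∑ E (λ a → ∑ xs (λ b → 𝟙 (P? b ×-dec (f b ≟ a))))       ≡⟨ ∑-comm E xs _ ⟩
      ∑ xs (λ b → ∑ E (λ a → 𝟙 (P? b ×-dec (f b ≟ a))))       ≡⟨ ∑-cong xs fibre ⟩
      ∑ xs (𝟙 ∘ P?)                                           ≡⟨ count≡∑ P? xs ⟨
      count P? xs                                             ∎
      where
        open ≡-Reasoning
        fibre : ∀ b → ∑ E (λ a → 𝟙 (P? b ×-dec (f b ≟ a))) ≡ 𝟙 (P? b)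
        fibre b with P? b
        ... | yes p = begin
          ∑ E (λ a → 𝟙 (yes p ×-dec (f b ≟ a)))   ≡⟨ ∑-cong E (λ a → 𝟙-cong (mk⇔ (sym ∘ proj₂) (λ a≡fb → p , sym a≡fb))
                                                                        _ (a ≟ f b)) ⟩
          ∑ E (λ a → 𝟙 (a ≟ f b))                 ≡⟨ count≡∑ (_≟ f b) E ⟨
          count (_≟ f b) E                        ≡⟨ count-≡ _≟_ (f b) ⟩
          1                                       ∎
        ... | no ¬p = trans (∑-cong E (λ a → 𝟙-no (¬p ∘ proj₁) (no ¬p ×-dec (f b ≟ a)))) (∑-ε E)

module FibreArithmetic where

  open import Data.Nat using (_+_; _*_)
  open import Data.Nat.Solver using (module +-*-Solver)
  open +-*-Solver using (solve; _:=_; _:+_; _:*_; con)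
  open ≡-Reasoning

  -- Q = suc q; in the application S = Σₐ Nₐ, n₀ = N₀ and n₁ = Nₐ for every a ≠ 0.
  fibre-balance : ∀ q S n₀ n₁ → S + 1 ≡ suc q * suc q → S + n₁ ≡ n₀ + suc q * n₁ →
                  n₀ + q * n₁ ≡ q * (q + 2)
  fibre-balance q S n₀ n₁ total update = ℕ.+-cancelʳ-≡ n₁ _ _ (begin
    n₀ + q * n₁ + n₁      ≡⟨ solve 3 (λ n₀ q n₁ → n₀ :+ q :* n₁ :+ n₁ := n₀ :+ (con 1 :+ q) :* n₁) refl n₀ q n₁ ⟩
    n₀ + suc q * n₁       ≡⟨ update ⟨
    S + n₁                ≡⟨ cong (_+ n₁) S≡q[q+2] ⟩
    q * (q + 2) + n₁      ∎)
    where
      S≡q[q+2] : S ≡ q * (q + 2)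
      S≡q[q+2] = ℕ.+-cancelʳ-≡ 1 _ _
        (trans total (solve 1 (λ q → (con 1 :+ q) :* (con 1 :+ q) := q :* (q :+ con 2) :+ con 1) refl q))

  isotropic-fibres : ∀ q n₀ n₁ .{{_ : NonZero q}} → n₀ + 2 ≡ suc q + suc q → n₀ + q * n₁ ≡ q * (q + 2) →
                     n₀ ≡ 2 * q × n₁ ≡ q
  isotropic-fibres q n₀ n₁ zeros balance = n₀≡2q , ℕ.*-cancelˡ-≡ n₁ q q (ℕ.+-cancelˡ-≡ (2 * q) _ _ (begin
    2 * q + q * n₁        ≡⟨ cong (_+ q * n₁) n₀≡2q ⟨
    n₀ + q * n₁           ≡⟨ balance ⟩
    q * (q + 2)           ≡⟨ solve 1 (λ q → q :* (q :+ con 2) := con 2 :* q :+ q :* q) refl q ⟩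
    2 * q + q * q         ∎))
    where
      n₀≡2q : n₀ ≡ 2 * q
      n₀≡2q = ℕ.+-cancelʳ-≡ 2 _ _
        (trans zeros (solve 1 (λ q → (con 1 :+ q) :+ (con 1 :+ q) := con 2 :* q :+ con 2) refl q))

  anisotropic-fibres : ∀ q n₁ .{{_ : NonZero q}} → 0 + q * n₁ ≡ q * (q + 2) → n₁ ≡ suc q + 1
  anisotropic-fibres q n₁ balance = ℕ.*-cancelˡ-≡ n₁ (suc q + 1) q (trans balance (cong (q *_) (ℕ.+-suc q 1)))

open FibreArithmetic

module Field {m : ℕ} (K : FiniteField2 m) where

  open FiniteField2 K

  commutativeRing : CommutativeRing 0ℓ 0ℓ
  commutativeRing = record { isCommutativeRing = isCommutativeRing }

  open CommutativeRing commutativeRing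
    using (+-identityˡ; +-identityʳ; -‿inverseʳ; *-assoc; *-comm; *-identityˡ; *-identityʳ; zeroˡ; zeroʳ;
           distribʳ; +-commutativeSemigroup; *-isCommutativeMonoid; ring; *-monoid; *-commutativeMonoid)
  open import Algebra.Properties.CommutativeSemigroup +-commutativeSemigroup
    using () renaming (interchange to +-interchange)
  open BigOperator *-isCommutativeMonoid using (_·_)
    renaming (∑ to ∏; ∑-distrib to ∏-distrib; ∑-const to ∏-const; ∑-update to ∏-update; ∑-reindex to ∏-reindex)
  open ≡-Reasoning

  private variable
    a b c x y z : Carrier

  m≡suc : Σ ℕ λ m′ → m ≡ suc m′
  m≡suc = positive m card
    where
      positive : ∀ n → length elements ≡ 2 ^ℕ n → Σ ℕ λ n′ → n ≡ suc n′
      positive zero    card≡1 = contradiction (length≡1⇒≡ card≡1 (complete 0#) (complete 1#)) 0≢1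
      positive (suc n) _      = n , refl

  cancel-inverse : x * y ≡ 1# → ∀ z → y * (x * z) ≡ z
  cancel-inverse {x} {y} xy≡1 z = begin
    y * (x * z)   ≡⟨ *-assoc y x z ⟨
    (y * x) * z   ≡⟨ cong (_* z) (trans (*-comm y x) xy≡1) ⟩
    1# * z        ≡⟨ *-identityˡ z ⟩
    z             ∎

  *-cancelˡ : ¬ a ≡ 0# → a * b ≡ a * c → b ≡ c
  *-cancelˡ {a} {b} {c} a≢0 ab≡ac with inverse a a≢0
  ... | a⁻¹ , aa⁻¹≡1 = begin
    b               ≡⟨ cancel-inverse aa⁻¹≡1 b ⟨
    a⁻¹ * (a * b)   ≡⟨ cong (a⁻¹ *_) ab≡ac ⟩
    a⁻¹ * (a * c)   ≡⟨ cancel-inverse aa⁻¹≡1 c ⟩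
    c               ∎

  zero-product : a * b ≡ 0# → a ≡ 0# ⊎ b ≡ 0#
  zero-product {a} {b} ab≡0 with a ≟ 0#
  ... | yes a≡0 = inj₁ a≡0
  ... | no a≢0  = inj₂ (*-cancelˡ a≢0 (trans ab≡0 (sym (zeroʳ a))))

  *-nonzero : ¬ a ≡ 0# → ¬ b ≡ 0# → ¬ a * b ≡ 0#
  *-nonzero a≢0 b≢0 ab≡0 = [ a≢0 , b≢0 ]′ (zero-product ab≡0)

  scaling : ¬ a ≡ 0# → Carrier ↔ Carrier
  scaling {a} a≢0 with inverse a a≢0
  ... | a⁻¹ , aa⁻¹≡1 =
    mk↔ₛ′ (a *_) (a⁻¹ *_) (cancel-inverse (trans (*-comm a⁻¹ a) aa⁻¹≡1)) (cancel-inverse aa⁻¹≡1)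

  ^≡· : ∀ x n → x ^ n ≡ n · x
  ^≡· x zero    = refl
  ^≡· x (suc n) = cong (x *_) (^≡· x n)

  nonzeroPart : Carrier → Carrier
  nonzeroPart z with z ≟ 0#
  ... | yes _ = 1#
  ... | no _  = z

  nonzeroPart-≡0 : z ≡ 0# → nonzeroPart z ≡ 1#
  nonzeroPart-≡0 {z} z≡0 with z ≟ 0#
  ... | yes _  = refl
  ... | no z≢0 = contradiction z≡0 z≢0

  nonzeroPart-≢0 : ¬ z ≡ 0# → nonzeroPart z ≡ z
  nonzeroPart-≢0 {z} z≢0 with z ≟ 0#
  ... | yes z≡0 = contradiction z≡0 z≢0
  ... | no _    = refl

  nonzeroPart≢0 : ∀ z → ¬ nonzeroPart z ≡ 0#
  nonzeroPart≢0 z with z ≟ 0#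
  ... | yes _  = 0≢1 ∘ sym
  ... | no z≢0 = z≢0

  ∏-nonzero : ∀ {f : Carrier → Carrier} → (∀ z → ¬ f z ≡ 0#) → ∀ xs → ¬ ∏ xs f ≡ 0#
  ∏-nonzero f≢0 []       = 0≢1 ∘ sym
  ∏-nonzero f≢0 (z ∷ zs) = *-nonzero (f≢0 z) (∏-nonzero f≢0 zs)

  fermat : ∀ x → x ^ length elements ≡ x
  fermat x with x ≟ 0#
  ... | yes refl = zero^length elements (complete 0#)
    where
      zero^length : ∀ (xs : List Carrier) → a ∈ xs → 0# ^ length xs ≡ 0#
      zero^length (_ ∷ xs) _ = zeroˡ _
  ... | no x≢0 = *-cancelˡ (∏-nonzero nonzeroPart≢0 elements) (trans (*-comm P _) (trans x^Q*P≡x*P (*-comm x P)))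
    where
      Q = length elements
      P = ∏ elements nonzeroPart
      xP = ∏ elements (λ z → x * nonzeroPart z)
      x^Q*P≡x*P : x ^ Q * P ≡ x * P
      x^Q*P≡x*P = begin
        x ^ Q * P                                ≡⟨ cong (_* P) (trans (^≡· x Q) (sym (∏-const elements x))) ⟩
        ∏ elements (λ _ → x) * P                 ≡⟨ ∏-distrib elements (λ _ → x) nonzeroPart ⟨
        xP                                       ≡⟨ *-identityʳ _ ⟨
        xP * 1#                                  ≡⟨ cong (xP *_) (nonzeroPart-≡0 (zeroʳ x)) ⟨
        xP * nonzeroPart (x * 0#)                ≡⟨ ∏-update unique (complete 0#) (λ z z≢0 →
                                                      trans (cong (x *_) (nonzeroPart-≢0 z≢0))
                                                            (sym (nonzeroPart-≢0 (*-nonzero x≢0 z≢0)))) ⟩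
        x * nonzeroPart 0# * ∏ elements (nonzeroPart ∘ (x *_))
          ≡⟨ cong₂ (λ u v → x * u * v) (nonzeroPart-≡0 refl) (∏-reindex unique complete (scaling x≢0) nonzeroPart) ⟩
        x * 1# * P                               ≡⟨ cong (_* P) (*-identityʳ x) ⟩
        x * P                                    ∎

  -1≡1 : - 1# ≡ 1#
  -1≡1 with m≡suc
  ... | m′ , refl = begin
    - 1#                          ≡⟨ fermat (- 1#) ⟨
    (- 1#) ^ length elements      ≡⟨ cong ((- 1#) ^_) card ⟩
    (- 1#) ^ (2 *ℕ k)             ≡⟨ ^≡· (- 1#) (2 *ℕ k) ⟩
    (2 *ℕ k) · - 1#               ≡⟨ cong (_· - 1#) (ℕ.*-comm 2 k) ⟩
    (k *ℕ 2) · - 1#               ≡⟨ ×-assocˡ (- 1#) k 2 ⟨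
    k · (- 1# * (- 1# * 1#))      ≡⟨ cong (λ u → k · (- 1# * u)) (*-identityʳ (- 1#)) ⟩
    k · (- 1# * - 1#)             ≡⟨ cong (k ·_) (trans (-1*x≈-x (- 1#)) (-‿involutive 1#)) ⟩
    k · 1#                        ≡⟨ ×-idem (*-identityʳ 1#) k {{ℕ.m^n≢0 2 m′}} ⟩
    1#                            ∎
    where
      open import Algebra.Properties.Ring ring using (-1*x≈-x; -‿involutive)
      open import Algebra.Properties.Monoid.Mult *-monoid using (×-assocˡ; ×-idem)
      k = 2 ^ℕ m′

  1+1≡0 : 1# + 1# ≡ 0#
  1+1≡0 = trans (cong (1# +_) (sym -1≡1)) (-‿inverseʳ 1#)

  -- Coefficients in 𝔽₂ let the ring solver prove identities of characteristic 2 such as (a + b)² = a² + b².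
  private
    F₂ : RawRing 0ℓ 0ℓ
    F₂ = CommutativeRing.rawRing Bool.xor-∧-commutativeRing

    ⟦_⟧₂ : Bool → Carrier
    ⟦ false ⟧₂ = 0#
    ⟦ true ⟧₂  = 1#

    F₂-morphism : F₂ -Raw-AlmostCommutative⟶ fromCommutativeRing commutativeRing
    F₂-morphism = record
      { ⟦_⟧    = ⟦_⟧₂
      ; +-homo = +-homo
      ; *-homo = λ { false _ → sym (zeroˡ _) ; true _ → sym (*-identityˡ _) }
      ; -‿homo = λ { false → sym -0#≈0# ; true → sym -1≡1 }
      ; 0-homo = refl
      ; 1-homo = refl
      }
      where
        open import Algebra.Properties.Ring ring using (-0#≈0#)
        +-homo : ∀ a b → ⟦ a xor b ⟧₂ ≡ ⟦ a ⟧₂ + ⟦ b ⟧₂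
        +-homo false b     = sym (+-identityˡ _)
        +-homo true  false = sym (+-identityʳ 1#)
        +-homo true  true  = sym 1+1≡0

    coefficient≟ : ∀ a b → Maybe (⟦ a ⟧₂ ≡ ⟦ b ⟧₂)
    coefficient≟ a b = Maybe.map (cong ⟦_⟧₂) (dec⇒weaklyDec Bool._≟_ a b)

  open import Algebra.Solver.Ring F₂ (fromCommutativeRing commutativeRing) F₂-morphism coefficient≟
    using (solve; _:=_; _:+_; _:*_; con)

  sq-+ : ∀ a b → (a + b) * (a + b) ≡ a * a + b * b
  sq-+ = solve 2 (λ a b → (a :+ b) :* (a :+ b) := a :* a :+ b :* b) refl

  -- Frobenius and the absolute trace

  ^-+ : ∀ x a b → x ^ (a +ℕ b) ≡ x ^ a * x ^ b
  ^-+ x a b = begin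
    x ^ (a +ℕ b)        ≡⟨ ^≡· x (a +ℕ b) ⟩
    (a +ℕ b) · x        ≡⟨ ×-homo-+ x a b ⟩
    a · x * b · x       ≡⟨ cong₂ _*_ (^≡· x a) (^≡· x b) ⟨
    x ^ a * x ^ b       ∎
    where open import Algebra.Properties.Monoid.Mult *-monoid using (×-homo-+)

  ^-distrib-* : ∀ x y n → (x * y) ^ n ≡ x ^ n * y ^ n
  ^-distrib-* x y n = begin
    (x * y) ^ n         ≡⟨ ^≡· (x * y) n ⟩
    n · (x * y)         ≡⟨ ×-distrib-+ x y n ⟩
    n · x * n · y       ≡⟨ cong₂ _*_ (^≡· x n) (^≡· y n) ⟨
    x ^ n * y ^ n       ∎
    where open import Algebra.Properties.CommutativeMonoid.Mult *-commutativeMonoid using (×-distrib-+)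

  _^2^_ : Carrier → ℕ → Carrier
  x ^2^ k = x ^ (2 ^ℕ k)

  ^2^-suc : ∀ x k → x ^2^ suc k ≡ x ^2^ k * x ^2^ k
  ^2^-suc x k = trans (^-+ x (2 ^ℕ k) _) (cong (λ n → x ^2^ k * x ^ n) (ℕ.+-identityʳ (2 ^ℕ k)))

  ^2^-square : ∀ x k → (x * x) ^2^ k ≡ x ^2^ suc k
  ^2^-square x k = trans (^-distrib-* x x (2 ^ℕ k)) (sym (^2^-suc x k))

  ^2^-+ : ∀ a b k → (a + b) ^2^ k ≡ a ^2^ k + b ^2^ k
  ^2^-+ a b zero    = distribʳ 1# a b
  ^2^-+ a b (suc k) = begin
    (a + b) ^2^ suc k                                   ≡⟨ ^2^-suc (a + b) k ⟩
    (a + b) ^2^ k * (a + b) ^2^ k                       ≡⟨ cong (λ u → u * u) (^2^-+ a b k) ⟩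
    (a ^2^ k + b ^2^ k) * (a ^2^ k + b ^2^ k)           ≡⟨ sq-+ _ _ ⟩
    a ^2^ k * a ^2^ k + b ^2^ k * b ^2^ k               ≡⟨ cong₂ _+_ (^2^-suc a k) (^2^-suc b k) ⟨
    a ^2^ suc k + b ^2^ suc k                           ∎

  fermat-^2^ : ∀ x → x ^2^ m ≡ x
  fermat-^2^ x = trans (cong (x ^_) (sym card)) (fermat x)

  traceSum-+ : ∀ k a b → traceSum k (a + b) ≡ traceSum k a + traceSum k b
  traceSum-+ zero    a b = sym (+-identityˡ 0#)
  traceSum-+ (suc k) a b = trans (cong₂ _+_ (^2^-+ a b k) (traceSum-+ k a b)) (+-interchange _ _ _ _)

  traceSum-square : ∀ k a → traceSum k (a * a) ≡ traceSum k a + a + a ^2^ k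
  traceSum-square zero    a = solve 1 (λ a → con false := con false :+ a :+ a :* con true) refl a
  traceSum-square (suc k) a = begin
    (a * a) ^2^ k + traceSum k (a * a)                 ≡⟨ cong₂ _+_ (^2^-square a k) (traceSum-square k a) ⟩
    a ^2^ suc k + (traceSum k a + a + a ^2^ k)         ≡⟨ solve 4 (λ A T a B → A :+ (T :+ a :+ B) := B :+ T :+ a :+ A)
                                                                refl _ _ _ _ ⟩
    a ^2^ k + traceSum k a + a + a ^2^ suc k           ∎

  traceSum-frobenius : ∀ k a → traceSum k a * traceSum k a ≡ traceSum k (a * a)
  traceSum-frobenius zero    a = zeroˡ 0#
  traceSum-frobenius (suc k) a = begin
    (a ^2^ k + traceSum k a) * (a ^2^ k + traceSum k a)   ≡⟨ sq-+ _ _ ⟩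
    a ^2^ k * a ^2^ k + traceSum k a * traceSum k a       ≡⟨ cong₂ _+_ (sym (^2^-suc a k)) (traceSum-frobenius k a) ⟩
    a ^2^ suc k + traceSum k (a * a)                      ≡⟨ cong (_+ traceSum k (a * a)) (^2^-square a k) ⟨
    (a * a) ^2^ k + traceSum k (a * a)                    ∎

  Tr-square : ∀ a → Tr (a * a) ≡ Tr a
  Tr-square a = begin
    Tr (a * a)           ≡⟨ traceSum-square m a ⟩
    Tr a + a + a ^2^ m   ≡⟨ cong (Tr a + a +_) (fermat-^2^ a) ⟩
    Tr a + a + a         ≡⟨ solve 2 (λ t a → t :+ a :+ a := t) refl (Tr a) a ⟩
    Tr a                 ∎

  ℘ : Carrier → Carrier
  ℘ a = a * a + a

  Tr-℘ : ∀ a → Tr (℘ a) ≡ 0#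
  Tr-℘ a = begin
    Tr (a * a + a)      ≡⟨ traceSum-+ m (a * a) a ⟩
    Tr (a * a) + Tr a   ≡⟨ cong (_+ Tr a) (Tr-square a) ⟩
    Tr a + Tr a         ≡⟨ solve 1 (λ t → t :+ t := con false) refl (Tr a) ⟩
    0#                  ∎

  Tr∈𝔽₂ : ∀ a → Tr a ≡ 0# ⊎ Tr a ≡ 1#
  Tr∈𝔽₂ a with Tr a ≟ 0#
  ... | yes Tr≡0 = inj₁ Tr≡0
  ... | no Tr≢0  = inj₂ (*-cancelˡ Tr≢0 (begin
    Tr a * Tr a    ≡⟨ traceSum-frobenius m a ⟩
    Tr (a * a)     ≡⟨ Tr-square a ⟩
    Tr a           ≡⟨ *-identityʳ (Tr a) ⟨
    Tr a * 1#      ∎))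

  x+y≡0⇒x≡y : x + y ≡ 0# → x ≡ y
  x+y≡0⇒x≡y {x} {y} x+y≡0 = begin
    x              ≡⟨ solve 2 (λ x y → x := x :+ y :+ y) refl x y ⟩
    x + y + y      ≡⟨ cong (_+ y) x+y≡0 ⟩
    0# + y         ≡⟨ +-identityˡ y ⟩
    y              ∎

  -- f is a polynomial function of degree ≤ d in Horner form, c being its coefficient of Xᵈ.
  data Polynomial : ℕ → Carrier → (Carrier → Carrier) → Set where
    constant : ∀ {c f} → (∀ x → f x ≡ c) → Polynomial zero c f
    horner   : ∀ {d c f} b g → Polynomial d c g → (∀ x → f x ≡ b + x * g x) → Polynomial (suc d) c f

  private variable
    d : ℕ
    f g : Carrier → Carrier

  polynomial-+ : Polynomial d a f → Polynomial d b g → Polynomial d (a + b) (λ x → f x + g x)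
  polynomial-+ (constant f≡a) (constant g≡b) = constant (λ x → cong₂ _+_ (f≡a x) (g≡b x))
  polynomial-+ (horner b f′ pf f≡) (horner b′ g′ pg g≡) =
    horner (b + b′) (λ x → f′ x + g′ x) (polynomial-+ pf pg) λ x → begin
      _ + _                            ≡⟨ cong₂ _+_ (f≡ x) (g≡ x) ⟩
      b + x * f′ x + (b′ + x * g′ x)   ≡⟨ solve 5 (λ b b′ x u v → b :+ x :* u :+ (b′ :+ x :* v) := b :+ b′ :+ x :* (u :+ v))
                                                  refl b b′ x _ _ ⟩
      b + b′ + x * (f′ x + g′ x)       ∎

  polynomial-0 : ∀ d → Polynomial d 0# (λ _ → 0#)
  polynomial-0 zero    = constant (λ _ → refl)
  polynomial-0 (suc d) = horner 0# (λ _ → 0#) (polynomial-0 d) (λ x → sym (trans (+-identityˡ _) (zeroʳ x)))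

  monomial-top : ∀ d → Polynomial d 1# (_^ d)
  monomial-top zero    = constant (λ _ → refl)
  monomial-top (suc d) = horner 0# (_^ d) (monomial-top d) (λ x → sym (+-identityˡ _))

  monomial-low : ∀ {n d} → n < d → Polynomial d 0# (_^ n)
  monomial-low {zero}  {suc d} _         = horner 1# (λ _ → 0#) (polynomial-0 d)
                                               (λ x → sym (trans (cong (1# +_) (zeroʳ x)) (+-identityʳ 1#)))
  monomial-low {suc n} {suc d} (s<s n<d) = horner 0# (_^ n) (monomial-low n<d) (λ x → sym (+-identityˡ _))

  traceSum-polynomial : ∀ k {D} → 2 ^ℕ k ≤ D → Polynomial D 0# (traceSum k)
  traceSum-polynomial zero    {D} _     = polynomial-0 D
  traceSum-polynomial (suc k) {D} 2^k≤D = subst (λ c → Polynomial D c (traceSum (suc k))) (+-identityˡ 0#)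
    (polynomial-+ (monomial-low (ℕ.<-≤-trans (ℕ.^-monoʳ-< 2 (s≤s (s≤s z≤n)) (ℕ.n<1+n k)) 2^k≤D))
                  (traceSum-polynomial k (ℕ.≤-trans (ℕ.^-monoʳ-≤ 2 (ℕ.n≤1+n k)) 2^k≤D)))

  factor : Polynomial (suc d) c f → ∀ r →
           Σ (Carrier → Carrier) λ g → Polynomial d c g × (∀ x → f x ≡ f r + (x + r) * g x)
  factor {c = c} {f} (horner b g (constant g≡c) f≡) r = (λ _ → c) , constant (λ _ → refl) , λ x → begin
    f x                          ≡⟨ trans (f≡ x) (cong (λ u → b + x * u) (g≡c x)) ⟩
    b + x * c                    ≡⟨ solve 4 (λ b x r c → b :+ x :* c := b :+ r :* c :+ (x :+ r) :* c) refl b x r c ⟩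
    b + r * c + (x + r) * c      ≡⟨ cong (λ u → u + (x + r) * c) (trans (f≡ r) (cong (λ u → b + r * u) (g≡c r))) ⟨
    f r + (x + r) * c            ∎
  factor {f = f} (horner b g pg@(horner _ _ _ _) f≡) r with factor pg r
  ... | g′ , pg′ , g≡ = (λ x → g r + x * g′ x) , horner (g r) g′ pg′ (λ _ → refl) , λ x → begin
    f x                                   ≡⟨ trans (f≡ x) (cong (λ u → b + x * u) (g≡ x)) ⟩
    b + x * (g r + (x + r) * g′ x)            ≡⟨ solve 5 (λ b x r G H → b :+ x :* (G :+ (x :+ r) :* H)
                                                                    := b :+ r :* G :+ (x :+ r) :* (G :+ x :* H))
                                                           refl b x r (g r) (g′ x) ⟩
    b + r * g r + (x + r) * (g r + x * g′ x)  ≡⟨ cong (λ u → u + (x + r) * (g r + x * g′ x)) (f≡ r) ⟨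
    f r + (x + r) * (g r + x * g′ x)          ∎

  root-bound : Polynomial d c f → ∀ rs → Unique rs → d < length rs → (∀ {r} → r ∈ rs → f r ≡ 0#) →
               c ≡ 0#
  root-bound (constant f≡c) (r ∷ _) _ _ roots = trans (sym (f≡c r)) (roots (here refl))
  root-bound {f = f} p@(horner _ _ _ _) (r ∷ rs) (r∉rs ∷ unique) (s<s d<) roots with factor p r
  ... | g , pg , f≡ = root-bound pg rs unique d< g-root
    where
      g-root : ∀ {z} → z ∈ rs → g z ≡ 0#
      g-root {z} z∈rs = [ (λ z+r≡0 → contradiction (sym (x+y≡0⇒x≡y z+r≡0)) (All.lookup r∉rs z∈rs)) , id ]′
        (zero-product (begin
          (z + r) * g z               ≡⟨ +-identityˡ _ ⟨
          0# + (z + r) * g z          ≡⟨ cong (λ u → u + (z + r) * g z) (roots (here refl)) ⟨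
          f r + (z + r) * g z         ≡⟨ f≡ z ⟨
          f z                         ≡⟨ roots (there z∈rs) ⟩
          0#                          ∎))

  Tr-nontrivial : Σ Carrier λ δ → Tr δ ≡ 1#
  Tr-nontrivial with any? (λ z → ¬? (Tr z ≟ 0#)) elements
  ... | yes some = let δ , Trδ≢0 = satisfied some in
                   δ , [ (λ Trδ≡0 → contradiction Trδ≡0 Trδ≢0) , id ]′ (Tr∈𝔽₂ δ)
  ... | no none with m≡suc
  ...   | m′ , refl =
    contradiction (trans (sym (+-identityʳ 1#)) (root-bound Tr-polynomial elements unique D<Q Tr≡0)) (0≢1 ∘ sym)
    where
      D = 2 ^ℕ m′
      Tr-polynomial : Polynomial D (1# + 0#) Tr
      Tr-polynomial = polynomial-+ (monomial-top D) (traceSum-polynomial m′ ℕ.≤-refl)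
      D<Q : D < length elements
      D<Q = subst (D <_) (sym card) (ℕ.^-monoʳ-< 2 (s≤s (s≤s z≤n)) (ℕ.n<1+n m′))
      Tr≡0 : ∀ {z} → z ∈ elements → Tr z ≡ 0#
      Tr≡0 {z} _ = decidable-stable (Tr z ≟ 0#) (λ Tr≢0 → none (lose (complete z) Tr≢0))

  additive-hilbert90 : ∀ c → Tr c ≡ 0# → Σ Carrier λ w → ℘ w ≡ c
  additive-hilbert90 c Trc≡0 = W m , (begin
    ℘ (W m)                                ≡⟨ invariant m ⟩
    δ ^2^ m * (Tr c + c) + c * (Tr δ + δ)  ≡⟨ cong₂ (λ u v → u * (v + c) + c * (Tr δ + δ)) (fermat-^2^ δ) Trc≡0 ⟩
    δ * (0# + c) + c * (Tr δ + δ)          ≡⟨ cong (λ u → δ * (0# + c) + c * (u + δ)) Trδ≡1 ⟩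
    δ * (0# + c) + c * (1# + δ)            ≡⟨ solve 2 (λ δ c → δ :* (con false :+ c) :+ c :* (con true :+ δ) := c)
                                                refl δ c ⟩
    c                                      ∎)
    where
      δ = proj₁ Tr-nontrivial
      Trδ≡1 = proj₂ Tr-nontrivial
      W : ℕ → Carrier
      W zero    = 0#
      W (suc k) = W k + traceSum k c * δ ^2^ k
      invariant : ∀ k → ℘ (W k) ≡ δ ^2^ k * (traceSum k c + c) + c * (traceSum k δ + δ)
      invariant zero    = solve 2 (λ δ c → con false :* con false :+ con false
                                           := δ :* con true :* (con false :+ c) :+ c :* (con false :+ δ)) refl δ c
      invariant (suc k) = begin
        ℘ (W k + S * D)
          ≡⟨ solve 3 (λ W S D → (W :+ S :* D) :* (W :+ S :* D) :+ (W :+ S :* D)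
                                := W :* W :+ W :+ (S :* S) :* (D :* D) :+ S :* D) refl (W k) S D ⟩
        ℘ (W k) + (S * S) * (D * D) + S * D
          ≡⟨ cong₂ (λ u v → u + v * (D * D) + S * D) (invariant k) (trans (traceSum-frobenius k c) (traceSum-square k c)) ⟩
        D * (S + c) + c * (Sδ + δ) + (S + c + c ^2^ k) * (D * D) + S * D
          ≡⟨ solve 6 (λ D S c Sδ δ cₖ → D :* (S :+ c) :+ c :* (Sδ :+ δ) :+ (S :+ c :+ cₖ) :* (D :* D) :+ S :* D
                                        := (D :* D) :* (cₖ :+ S :+ c) :+ c :* (D :+ Sδ :+ δ)) refl D S c Sδ δ (c ^2^ k) ⟩
        (D * D) * (c ^2^ k + S + c) + c * (D + Sδ + δ)
          ≡⟨ cong (λ u → u * (c ^2^ k + S + c) + c * (D + Sδ + δ)) (^2^-suc δ k) ⟨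
        δ ^2^ suc k * (c ^2^ k + S + c) + c * (D + Sδ + δ)
          ∎
        where
          S  = traceSum k c
          D  = δ ^2^ k
          Sδ = traceSum k δ

  square-root : ∀ a → Σ Carrier λ l → l * l ≡ a
  square-root a with m≡suc
  ... | m′ , refl = a ^2^ m′ , trans (sym (^2^-suc a m′)) (fermat-^2^ a)

  -- The quadratic form of a line

  Point : Set
  Point = Carrier × Carrier

  origin : Point
  origin = 0# , 0#

  form : Point → Point → Carrier
  form (x , y) (s , t) = x * x * (t * t) + y * y * (s * s) + s * t

  _⊕_ : Point → Point → Point
  (s , t) ⊕ (x , y) = s + x , t + y

  ⊕-involutive : ∀ ℓ p → (p ⊕ ℓ) ⊕ ℓ ≡ p
  ⊕-involutive (x , y) (s , t) = cong₂ _,_ (+-involutive x s) (+-involutive y t)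
    where
      +-involutive : ∀ x s → s + x + x ≡ s
      +-involutive = solve 2 (λ x s → s :+ x :+ x := s) refl

  ρ̂-translate : ∀ ℓ p → ρ̂ ℓ (p ⊕ ℓ) ≡ form ℓ p
  ρ̂-translate (x , y) (s , t) = solve 4 (λ x y s t →
    (x :* x) :* ((t :+ y) :* (t :+ y)) :+ (y :* y) :* ((s :+ x) :* (s :+ x)) :+ (x :+ (s :+ x)) :* (y :+ (t :+ y))
      := x :* x :* (t :* t) :+ y :* y :* (s :* s) :+ s :* t) refl x y s t

  form-homogeneous : ∀ ℓ l s t → form ℓ (l * s , l * t) ≡ (l * l) * form ℓ (s , t)
  form-homogeneous (x , y) l s t = solve 5 (λ x y l s t →
    x :* x :* ((l :* t) :* (l :* t)) :+ y :* y :* ((l :* s) :* (l :* s)) :+ (l :* s) :* (l :* t)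
      := (l :* l) :* (x :* x :* (t :* t) :+ y :* y :* (s :* s) :+ s :* t)) refl x y l s t

  isotropic⇒Tr≡0 : ∀ x y γ → form (x , y) (1# , γ) ≡ 0# → Tr (x * y) ≡ 0#
  isotropic⇒Tr≡0 x y γ isotropic = begin
    Tr (x * y)                  ≡⟨ Tr-square (x * y) ⟨
    Tr ((x * y) * (x * y))      ≡⟨ cong Tr xy²≡℘ ⟩
    Tr (℘ (x * x * γ))          ≡⟨ Tr-℘ (x * x * γ) ⟩
    0#                          ∎
    where
      xy²≡℘ : (x * y) * (x * y) ≡ ℘ (x * x * γ)
      xy²≡℘ = begin
        (x * y) * (x * y)
          ≡⟨ solve 3 (λ x y γ → (x :* y) :* (x :* y)
                                := x :* x :* (x :* x :* (γ :* γ) :+ y :* y :* (con true :* con true) :+ con true :* γ)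
                                   :+ ((x :* x :* γ) :* (x :* x :* γ) :+ x :* x :* γ)) refl x y γ ⟩
        x * x * form (x , y) (1# , γ) + ℘ (x * x * γ)  ≡⟨ cong (λ u → x * x * u + ℘ (x * x * γ)) isotropic ⟩
        x * x * 0# + ℘ (x * x * γ)                     ≡⟨ cong (_+ ℘ (x * x * γ)) (zeroʳ (x * x)) ⟩
        0# + ℘ (x * x * γ)                             ≡⟨ +-identityˡ _ ⟩
        ℘ (x * x * γ)                                  ∎

  form-0-isotropic : ∀ y → form (0# , y) (1# , y * y) ≡ 0#
  form-0-isotropic = solve 1 (λ y → con false :* con false :* ((y :* y) :* (y :* y))
                                    :+ y :* y :* (con true :* con true) :+ con true :* (y :* y) := con false) refl

  Tr≡0⇒isotropic : ∀ x y → Tr (x * y) ≡ 0# → Σ Carrier λ γ → form (x , y) (1# , γ) ≡ 0#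
  Tr≡0⇒isotropic x y Trxy≡0 with x ≟ 0#
  ... | yes refl = y * y , form-0-isotropic y
  ... | no x≢0 = i * i * w , (begin
    form (x , y) (1# , i * i * w)                 ≡⟨ cong (λ u → form (x , y) (u , i * i * w)) i²x²≡1 ⟨
    form (x , y) (i * i * (x * x) , i * i * w)    ≡⟨ form-homogeneous (x , y) (i * i) (x * x) w ⟩
    (i * i) * (i * i) * form (x , y) (x * x , w)  ≡⟨ cong ((i * i) * (i * i) *_) isotropic ⟩
    (i * i) * (i * i) * 0#                        ≡⟨ zeroʳ _ ⟩
    0#                                            ∎)
    where
      i = proj₁ (inverse x x≢0)
      xi≡1 = proj₂ (inverse x x≢0)
      w = proj₁ (additive-hilbert90 ((x * y) * (x * y)) (trans (Tr-square (x * y)) Trxy≡0))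
      ℘w≡xy² = proj₂ (additive-hilbert90 ((x * y) * (x * y)) (trans (Tr-square (x * y)) Trxy≡0))
      i²x²≡1 : i * i * (x * x) ≡ 1#
      i²x²≡1 = begin
        i * i * (x * x)      ≡⟨ solve 2 (λ i x → i :* i :* (x :* x) := (x :* i) :* (x :* i)) refl i x ⟩
        (x * i) * (x * i)    ≡⟨ cong (λ u → u * u) xi≡1 ⟩
        1# * 1#              ≡⟨ *-identityʳ 1# ⟩
        1#                   ∎
      isotropic : form (x , y) (x * x , w) ≡ 0#
      isotropic = begin
        form (x , y) (x * x , w)
          ≡⟨ solve 3 (λ x y w → x :* x :* (w :* w) :+ y :* y :* ((x :* x) :* (x :* x)) :+ (x :* x) :* w
                                := x :* x :* ((w :* w :+ w) :+ (x :* y) :* (x :* y))) refl x y w ⟩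
        x * x * (℘ w + (x * y) * (x * y))                  ≡⟨ cong (λ u → x * x * (u + (x * y) * (x * y))) ℘w≡xy² ⟩
        x * x * ((x * y) * (x * y) + (x * y) * (x * y))    ≡⟨ solve 2 (λ x u → x :* x :* (u :+ u) := con false)
                                                                refl x ((x * y) * (x * y)) ⟩
        0#                                                 ∎

  anisotropic : ∀ x y p → ¬ Tr (x * y) ≡ 0# → form (x , y) p ≡ 0# → p ≡ origin
  anisotropic x y (s , t) Trxy≢0 form≡0 with s ≟ 0#
  ... | yes refl = cong (0# ,_) ([ (λ x≡0 → contradiction x≡0 x≢0) , id ]′ (zero-product xt≡0))
    where
      x≢0 : ¬ x ≡ 0#
      x≢0 x≡0 = Trxy≢0 (trans (cong (λ u → Tr (u * y)) x≡0) (isotropic⇒Tr≡0 0# y (y * y) (form-0-isotropic y)))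
      xt≡0 : x * t ≡ 0#
      xt≡0 = [ id , id ]′ (zero-product (begin
        (x * t) * (x * t)          ≡⟨ solve 3 (λ x y t → (x :* t) :* (x :* t)
                                                 := x :* x :* (t :* t) :+ y :* y :* (con false :* con false) :+ con false :* t)
                                          refl x y t ⟩
        form (x , y) (0# , t)      ≡⟨ form≡0 ⟩
        0#                         ∎))
  ... | no s≢0 = contradiction (isotropic⇒Tr≡0 x y (i * t) (begin
    form (x , y) (1# , i * t)              ≡⟨ cong (λ u → form (x , y) (u , i * t)) (trans (*-comm i s) si≡1) ⟨
    form (x , y) (i * s , i * t)           ≡⟨ form-homogeneous (x , y) i s t ⟩
    (i * i) * form (x , y) (s , t)         ≡⟨ cong ((i * i) *_) form≡0 ⟩
    (i * i) * 0#                           ≡⟨ zeroʳ _ ⟩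
    0#                                     ∎)) Trxy≢0
    where
      i = proj₁ (inverse s s≢0)
      si≡1 = proj₂ (inverse s s≢0)

  shearˡ : Carrier → Point → Point
  shearˡ β (s , t) = s + β * t , t

  shearʳ : Carrier → Point → Point
  shearʳ γ (s , t) = s , t + γ * s

  shearˡ-involutive : ∀ β p → shearˡ β (shearˡ β p) ≡ p
  shearˡ-involutive β (s , t) = cong (_, t) (solve 3 (λ β s t → s :+ β :* t :+ β :* t := s) refl β s t)

  shearʳ-involutive : ∀ γ p → shearʳ γ (shearʳ γ p) ≡ p
  shearʳ-involutive γ (s , t) = cong (s ,_) (solve 3 (λ γ s t → t :+ γ :* s :+ γ :* s := t) refl γ s t)

  shearˡ-origin : ∀ β → shearˡ β origin ≡ origin
  shearˡ-origin β = cong (_, 0#) (trans (+-identityˡ _) (zeroʳ β))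

  shearʳ-origin : ∀ γ → shearʳ γ origin ≡ origin
  shearʳ-origin γ = cong (0# ,_) (trans (+-identityˡ _) (zeroʳ γ))

  -- The composite shear maps the axis t = 0 onto the isotropic line through (1, γ).
  form-sheared : ∀ x y γ → form (x , y) (1# , γ) ≡ 0# → ∀ p →
                 form (x , y) (shearʳ γ (shearˡ (x * x) p)) ≡ proj₁ p * proj₂ p
  form-sheared x y γ isotropic (s , t) = begin
    form (x , y) (s′ , t + γ * s′)
      ≡⟨ solve 5 (λ x y γ s′ t → x :* x :* ((t :+ γ :* s′) :* (t :+ γ :* s′)) :+ y :* y :* (s′ :* s′) :+ s′ :* (t :+ γ :* s′)
                                 := x :* x :* (t :* t) :+ s′ :* t
                                    :+ (s′ :* s′) :* (x :* x :* (γ :* γ) :+ y :* y :* (con true :* con true) :+ con true :* γ))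
                 refl x y γ s′ t ⟩
    x * x * (t * t) + s′ * t + (s′ * s′) * form (x , y) (1# , γ)
      ≡⟨ cong (λ u → x * x * (t * t) + s′ * t + (s′ * s′) * u) isotropic ⟩
    x * x * (t * t) + s′ * t + (s′ * s′) * 0#
      ≡⟨ solve 4 (λ x s t z → x :* x :* (t :* t) :+ (s :+ x :* x :* t) :* t :+ z :* con false := s :* t) refl x s t (s′ * s′) ⟩
    s * t
      ∎
    where s′ = s + x * x * t

module Lines {m : ℕ} (K : FiniteField2 m) where

  open FiniteField2 K
  open Field K
  open CommutativeRing commutativeRing using (+-identityˡ; zeroˡ; zeroʳ; *-identityʳ)
  open Counting
  open ≡-Reasoning

  Q : ℕ
  Q = length elements

  plane-unique : Unique nonTangentLines
  plane-unique = Unique.cartesianProduct⁺ unique unique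

  plane-complete : ∀ p → p ∈ nonTangentLines
  plane-complete (s , t) = ∈-cartesianProduct⁺ (complete s) (complete t)

  open Enumeration plane-unique plane-complete using (count-reindex) renaming (count-≢ to plane-count-≢)
  open Enumeration unique complete using (count-≡; count-≢; count-fibres)

  solutions : (Point → Carrier) → Carrier → ℕ
  solutions f a = count (λ p → ¬? (p ≟² origin) ×-dec (f p ≟ a)) nonTangentLines

  v≡solutions : ∀ ℓ a → v K ℓ a ≡ solutions (form ℓ) a
  v≡solutions ℓ a = count-reindex translation _ _ λ p →
      ¬-cong-⇔ (to-≡-⇔ translation (cong₂ _,_ (+-identityˡ _) (+-identityˡ _)) p)
        ×-⇔ mk⇔ (trans (sym (ρ̂-translate ℓ p))) (trans (ρ̂-translate ℓ p))
    where
      translation : Point ↔ Point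
      translation = mk↔ₛ′ (_⊕ ℓ) (_⊕ ℓ) (⊕-involutive ℓ) (⊕-involutive ℓ)

  solutions-reindex : ∀ {f g a b} (σ : Point ↔ Point) → Inverse.to σ origin ≡ origin →
                      (∀ p → f (Inverse.to σ p) ≡ a ⇔ g p ≡ b) → solutions f a ≡ solutions g b
  solutions-reindex σ σ0≡0 level⇔ = count-reindex σ _ _ λ p → ¬-cong-⇔ (to-≡-⇔ σ σ0≡0 p) ×-⇔ level⇔ p

  solutions-nonzero-level : ∀ ℓ {a} → ¬ a ≡ 0# → solutions (form ℓ) a ≡ solutions (form ℓ) 1#
  solutions-nonzero-level ℓ {a} a≢0 with square-root a
  ... | l , ll≡a = solutions-reindex dilation (cong₂ _,_ (zeroʳ l) (zeroʳ l)) λ (s , t) →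
      mk⇔ (λ e → *-cancelˡ a≢0 (trans (sym (scaled s t)) (trans e (sym (*-identityʳ a)))))
          (λ e → trans (scaled s t) (trans (cong (a *_) e) (*-identityʳ a)))
    where
      l≢0 : ¬ l ≡ 0#
      l≢0 l≡0 = a≢0 (trans (sym ll≡a) (trans (cong (_* l) l≡0) (zeroˡ l)))
      dilation : Point ↔ Point
      dilation = scaling l≢0 ×-↔ scaling l≢0
      scaled : ∀ s t → form ℓ (l * s , l * t) ≡ a * form ℓ (s , t)
      scaled s t = trans (form-homogeneous ℓ l s t) (cong (_* form ℓ (s , t)) ll≡a)

  ∑-solutions : ∀ f → ∑ elements (solutions f) +ℕ 1 ≡ Q *ℕ Q
  ∑-solutions f = begin
    ∑ elements (solutions f) +ℕ 1                        ≡⟨ cong (_+ℕ 1) (count-fibres _≟_ nonzero? f nonTangentLines) ⟩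
    count nonzero? nonTangentLines +ℕ 1                  ≡⟨ plane-count-≢ _≟²_ origin ⟩
    length nonTangentLines                               ≡⟨ length-cartesianProduct elements elements ⟩
    Q *ℕ Q                                               ∎
    where
      nonzero? = λ p → ¬? (p ≟² origin)

  ∑-solutions-levels : ∀ ℓ → ∑ elements (solutions (form ℓ)) +ℕ solutions (form ℓ) 1#
                             ≡ solutions (form ℓ) 0# +ℕ Q *ℕ solutions (form ℓ) 1#
  ∑-solutions-levels ℓ = begin
    ∑ elements (solutions (form ℓ)) +ℕ solutions (form ℓ) 1#
      ≡⟨ ∑-update unique (complete 0#) (λ a a≢0 → solutions-nonzero-level ℓ a≢0) ⟩
    solutions (form ℓ) 0# +ℕ ∑ elements (λ _ → solutions (form ℓ) 1#)
      ≡⟨ cong (solutions (form ℓ) 0# +ℕ_) (trans (∑-const elements _) (·≡* Q _)) ⟩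
    solutions (form ℓ) 0# +ℕ Q *ℕ solutions (form ℓ) 1#  ∎

  solutions-anisotropic : ∀ x y → ¬ Tr (x * y) ≡ 0# → solutions (form (x , y)) 0# ≡ 0
  solutions-anisotropic x y Tr≢0 =
    count-none _ (λ p (p≢0 , form≡0) → p≢0 (anisotropic x y p Tr≢0 form≡0)) nonTangentLines

  solutions-product : solutions (λ p → proj₁ p * proj₂ p) 0# +ℕ 2 ≡ Q +ℕ Q
  solutions-product = begin
    solutions (λ p → proj₁ p * proj₂ p) 0# +ℕ 2    ≡⟨ cong (_+ℕ 2) (count-cartesianProduct _ elements elements) ⟩
    ∑ elements h +ℕ 2                              ≡⟨ ℕ.+-assoc (∑ elements h) 1 1 ⟨
    ∑ elements h +ℕ 1 +ℕ 1                         ≡⟨ cong (_+ℕ 1) (∑-update unique (complete 0#) h≡1) ⟩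
    h 0# +ℕ ∑ elements (λ _ → 1) +ℕ 1              ≡⟨ cong (λ n → h 0# +ℕ n +ℕ 1)
                                                        (trans (∑-const elements 1) (trans (·≡* Q 1) (ℕ.*-identityʳ Q))) ⟩
    h 0# +ℕ Q +ℕ 1                                 ≡⟨ ℕ.+-comm (h 0# +ℕ Q) 1 ⟩
    suc (h 0# +ℕ Q)                                ≡⟨ cong (_+ℕ Q) (trans (ℕ.+-comm 1 (h 0#)) h0+1≡Q) ⟩
    Q +ℕ Q                                         ∎
    where
      h : Carrier → ℕ
      h s = count (λ t → ¬? ((s , t) ≟² origin) ×-dec ((s * t) ≟ 0#)) elements
      h≡1 : ∀ s → ¬ s ≡ 0# → h s ≡ 1
      h≡1 s s≢0 = trans (count-cong _ (_≟ 0#) (λ t → mk⇔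
          (λ (_ , st≡0) → [ (λ s≡0 → contradiction s≡0 s≢0) , id ]′ (zero-product st≡0))
          (λ t≡0 → (λ st≡0 → s≢0 (cong proj₁ st≡0)) , trans (cong (s *_) t≡0) (zeroʳ s))) elements)
        (count-≡ _≟_ 0#)
      h0+1≡Q : h 0# +ℕ 1 ≡ Q
      h0+1≡Q = trans (cong (_+ℕ 1) (count-cong _ (λ t → ¬? (t ≟ 0#)) (λ t → mk⇔
          (λ (0t≢0 , _) t≡0 → 0t≢0 (cong (0# ,_) t≡0))
          (λ t≢0 → (λ 0t≡0 → t≢0 (cong proj₂ 0t≡0)) , zeroˡ t)) elements))
        (count-≢ _≟_ 0#)

  solutions-isotropic : ∀ x y → Tr (x * y) ≡ 0# → solutions (form (x , y)) 0# +ℕ 2 ≡ Q +ℕ Q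
  solutions-isotropic x y Tr≡0 with Tr≡0⇒isotropic x y Tr≡0
  ... | γ , isotropic = trans (cong (_+ℕ 2) (solutions-reindex shear shear-origin λ p →
          mk⇔ (trans (sym (form-sheared x y γ isotropic p))) (trans (form-sheared x y γ isotropic p))))
        solutions-product
    where
      shear : Point ↔ Point
      shear = mk↔ₛ′ (shearʳ γ) (shearʳ γ) (shearʳ-involutive γ) (shearʳ-involutive γ)
          ↔-∘ mk↔ₛ′ (shearˡ (x * x)) (shearˡ (x * x)) (shearˡ-involutive (x * x)) (shearˡ-involutive (x * x))
      shear-origin : Inverse.to shear origin ≡ origin
      shear-origin = trans (cong (shearʳ γ) (shearˡ-origin (x * x))) (shearʳ-origin γ)

  q : ℕ
  q = 2 ^ℕ m ∸ 1

  1+q≡2^m : suc q ≡ 2 ^ℕ m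
  1+q≡2^m = ℕ.suc-pred (2 ^ℕ m) {{ℕ.m^n≢0 2 m}}

  Q≡1+q : Q ≡ suc q
  Q≡1+q = trans card (sym 1+q≡2^m)

  q-nonzero : NonZero q
  q-nonzero with m≡suc
  ... | m′ , refl = >-nonZero (ℕ.m<n⇒0<n∸m (ℕ.^-monoʳ-< 2 (s≤s (s≤s z≤n)) (s≤s (z≤n {m′}))))

  solutions-balance : ∀ ℓ → solutions (form ℓ) 0# +ℕ q *ℕ solutions (form ℓ) 1# ≡ q *ℕ (q +ℕ 2)
  solutions-balance ℓ = fibre-balance q _ _ _
    (trans (∑-solutions (form ℓ)) (cong (λ n → n *ℕ n) Q≡1+q))
    (trans (∑-solutions-levels ℓ) (cong (λ n → solutions (form ℓ) 0# +ℕ n *ℕ solutions (form ℓ) 1#) Q≡1+q))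

mainTheorem16 : (m : ℕ) (K : FiniteField2 m) (ε : Sign)
                (x y : FiniteField2.Carrier K) →
                FiniteField2.Tr K (FiniteField2._*_ K x y) ≡ trOf K ε →
                (a : FiniteField2.Carrier K) →
                (a ≡ FiniteField2.0# K → v K (x , y) a ≡ vZero m ε) ×
                (¬ (a ≡ FiniteField2.0# K) → v K (x , y) a ≡ vNonzero m ε)
mainTheorem16 m K plus x y Tr≡0 a =
    (λ a≡0 → trans (v≡solutions ℓ a) (trans (cong N a≡0) (proj₁ fibres))) ,
    (λ a≢0 → trans (v≡solutions ℓ a) (trans (solutions-nonzero-level ℓ a≢0) (proj₂ fibres)))
  where
    open Field K using (form)
    open Lines K
    ℓ = (x , y)
    N = solutions (form ℓ)
    fibres = isotropic-fibres q _ _ {{q-nonzero}}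
               (trans (solutions-isotropic x y Tr≡0) (cong (λ n → n +ℕ n) Q≡1+q)) (solutions-balance ℓ)
mainTheorem16 m K minus x y Tr≡1 a =
    (λ a≡0 → trans (v≡solutions ℓ a) (trans (cong N a≡0) no-zeros)) ,
    (λ a≢0 → trans (v≡solutions ℓ a)
               (trans (solutions-nonzero-level ℓ a≢0) (trans N₁≡q+2 (cong (_+ℕ 1) 1+q≡2^m))))
  where
    open FiniteField2 K using (1#; 0≢1)
    open Field K using (form)
    open Lines K
    ℓ = (x , y)
    N = solutions (form ℓ)
    no-zeros = solutions-anisotropic x y (λ Tr≡0 → 0≢1 (trans (sym Tr≡0) Tr≡1))
    N₁≡q+2 = anisotropic-fibres q (N 1#) {{q-nonzero}}
               (subst (λ n₀ → n₀ +ℕ q *ℕ N 1# ≡ q *ℕ (q +ℕ 2)) no-zeros (solutions-balance ℓ))
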